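{- Let $(\mathcal{A},\nu)$ and $(\mathcal{B},\nu)$ be effective topologies (with the same coding $\nu$) having recursively enumerable subset relations, such that $\mathcal{B}\subseteq\mathcal{A}$ and $\mathcal{A}$ and $\mathcal{B}$ are bases for the same topology. If $\phi$ is an oracle for $x$ in $(\mathcal{A},\nu)$, then there exists an oracle $\psi$ for $x$ in $(\mathcal{B},\nu)$ that is recursive relative to $\phi$ uniformly.
   Context: A coding of a countable basis $\mathcal{B}$ is a (not necessarily injective) assignment $n\mapsto\nu(n)$ of sets to non-negative integers such that every member of $\mathcal{B}$ is coded; $\mathrm{dom}_{\mathcal{B}}\nu$ denotes the set of non-negative integers $n$ with $\nu(n)\in\mathcal{B}$. $(\mathcal{B},\nu)$ is an effective topology iff $\mathcal{B}$ is a countable basis for a $T_0$ topology and $\nu$ is a coding of $\mathcal{B}$. A set $\mathcal{L}_x\subseteq\mathcal{B}$ is a local basis for $x$ iff every member contains $x$ and every $B\in\mathcal{B}$ containing $x$ has a subset in $\mathcal{L}_x$. With $\mathbb{N}$ the non-negative integers, $\phi:\mathbb{N}\to\mathrm{dom}_{\mathcal{B}}\nu$ is an oracle for $x$ in $(\mathcal{B},\nu)$ iff $\{\nu(\phi(n)):n\in\mathbb{N}\}$ is a local basis for $x$. The subset relation of $(\mathcal{B},\nu)$ is recursively enumerable iff $\{\langle b_1,b_2\rangle: b_1,b_2\in\mathrm{dom}_{\mathcal{B}}\nu,\ \nu(b_1)\subseteq\nu(b_2)\}$ is recursively enumerable (Cantor pairing). "Recursive relative to $\phi$ uniformly" means computed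 from $\phi$ by an oracle Turing machine not depending on $\phi$. -}

module Defs where

open import Level using (0ℓ)
open import Data.Nat using (ℕ; zero; suc; _+_; _<_)
open import Data.Fin using (Fin)
open import Data.Vec using (Vec; []; _∷_; lookup)
open import Data.Product using (Σ; ∃; _×_; _,_)
open import Data.Sum using (_⊎_)
open import Relation.Nullary using (¬_)
open import Relation.Unary using (Pred; _∈_; _∉_; _⊆_)
open import Relation.Binary.PropositionalEquality using (_≡_)
open import Function.Bundles using (_⇔_)

-- Computability: Kleene's partial recursive functions with an oracle
-- α : ℕ → ℕ.  A code of arity k denotes a partial function ℕᵏ ⇀ ℕ.

data Code : ℕ → Set where
  zer  : ∀ {k} → Code k
  succ : Code 1
  proj : ∀ {k} → Fin k → Code k
  orc  : Code 1
  comp : ∀ {k m} → Code m → Vec (Code k) m → Code k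
  prec : ∀ {k} → Code k → Code (suc (suc k)) → Code (suc k)
    -- primitive recursion: h(0,x)=f(x), h(n+1,x)=g(n,h(n,x),x)
  mu   : ∀ {k} → Code (suc k) → Code k

mutual
  data Eval (α : ℕ → ℕ) : ∀ {k} → Code k → Vec ℕ k → ℕ → Set where
    ezer  : ∀ {k} {xs : Vec ℕ k} → Eval α zer xs 0
    esucc : ∀ {x} → Eval α succ (x ∷ []) (suc x)
    eproj : ∀ {k} {i : Fin k} {xs} → Eval α (proj i) xs (lookup xs i)
    eorc  : ∀ {x} → Eval α orc (x ∷ []) (α x)
    ecomp : ∀ {k m} {f : Code m} {gs : Vec (Code k) m} {xs ys v} →
            EvalAll α gs xs ys → Eval α f ys v → Eval α (comp f gs) xs v
    eprec0 : ∀ {k} {f : Code k} {g} {xs v} →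
             Eval α f xs v → Eval α (prec f g) (0 ∷ xs) v
    eprecS : ∀ {k} {f : Code k} {g} {n xs w v} →
             Eval α (prec f g) (n ∷ xs) w → Eval α g (n ∷ w ∷ xs) v →
             Eval α (prec f g) (suc n ∷ xs) v
    emu   : ∀ {k} {f : Code (suc k)} {xs y} →
            Eval α f (y ∷ xs) 0 →
            (∀ z → z < y → ∃ λ w → Eval α f (z ∷ xs) (suc w)) →
            Eval α (mu f) xs y

  data EvalAll (α : ℕ → ℕ) {k : ℕ} : ∀ {m} → Vec (Code k) m → Vec ℕ k → Vec ℕ m → Set where
    []  : ∀ {xs} → EvalAll α [] xs []
    _∷_ : ∀ {m g} {gs : Vec (Code k) m} {xs y ys} →
          Eval α g xs y → EvalAll α gs xs ys → EvalAll α (g ∷ gs) xs (y ∷ ys)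

-- Halting of a (non-oracle, i.e. recursive) unary machine: we use the
-- recursive oracle λ _ → 0, so only recursive functions are computed.
Halts : Code 1 → ℕ → Set
Halts c n = ∃ λ v → Eval (λ _ → 0) c (n ∷ []) v

RE : Pred ℕ 0ℓ → Set
RE S = ∃ λ (c : Code 1) → ∀ n → (S n ⇔ Halts c n)

-- Cantor pairing ⟨a , b⟩ = (a+b)(a+b+1)/2 + b
tri : ℕ → ℕ
tri zero = zero
tri (suc n) = suc n + tri n

⟨_,_⟩ : ℕ → ℕ → ℕ
⟨ a , b ⟩ = tri (a + b) + b

-- Topology on a carrier X.  Subsets are predicates; a family of subsets
-- is a predicate on subsets, with membership taken up to extensional
-- equality of subsets.

module _ {X : Set} where

  Subset : Set₁
  Subset = Pred X 0ℓ

  Family : Set₁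
  Family = Pred Subset 0ℓ

  _≐_ : Subset → Subset → Set
  U ≐ V = U ⊆ V × V ⊆ U

  _∈ᶠ_ : Subset → Family → Set₁
  U ∈ᶠ 𝒜 = ∃ λ V → 𝒜 V × U ≐ V

  _⊆ᶠ_ : Family → Family → Set₁
  𝒜 ⊆ᶠ 𝓑 = ∀ U → 𝒜 U → U ∈ᶠ 𝓑

  OpenIn : Family → Subset → Set₁
  OpenIn 𝒜 U = ∀ x → x ∈ U → ∃ λ V → 𝒜 V × x ∈ V × V ⊆ U

  IsBasis : Family → Set₁
  IsBasis 𝒜 =
    (∀ x → ∃ λ V → 𝒜 V × x ∈ V) ×
    (∀ U V x → 𝒜 U → 𝒜 V → x ∈ U → x ∈ V →
       ∃ λ W → 𝒜 W × x ∈ W × W ⊆ U × W ⊆ V)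

  IsT0 : Family → Set₁
  IsT0 𝒜 = ∀ x y → ¬ x ≡ y →
    ∃ λ U → OpenIn 𝒜 U × ((x ∈ U × y ∉ U) ⊎ (y ∈ U × x ∉ U))

  SameTopology : Family → Family → Set₁
  SameTopology 𝒜 𝓑 = ∀ U → OpenIn 𝒜 U ⇔ OpenIn 𝓑 U

  IsCoding : Family → (ℕ → Subset) → Set₁
  IsCoding 𝒜 ν = ∀ U → 𝒜 U → ∃ λ n → ν n ≐ U

  EffectiveTopology : Family → (ℕ → Subset) → Set₁
  EffectiveTopology 𝒜 ν = IsBasis 𝒜 × IsT0 𝒜 × IsCoding 𝒜 ν

  Dom : Family → (ℕ → Subset) → ℕ → Set₁
  Dom 𝒜 ν n = ν n ∈ᶠ 𝒜

  SubsetRelRE : Family → (ℕ → Subset) → Set₁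
  SubsetRelRE 𝒜 ν = ∃ λ (c : Code 1) → ∀ m →
    ((∃ λ b₁ → ∃ λ b₂ → m ≡ ⟨ b₁ , b₂ ⟩ × Dom 𝒜 ν b₁ × Dom 𝒜 ν b₂ × ν b₁ ⊆ ν b₂)
      ⇔ Halts c m)

  IsOracleFor : Family → (ℕ → Subset) → X → (ℕ → ℕ) → Set₁
  IsOracleFor 𝒜 ν x φ =
    (∀ n → Dom 𝒜 ν (φ n)) ×
    (∀ n → x ∈ ν (φ n)) ×
    (∀ V → 𝒜 V → x ∈ V → ∃ λ n → ν (φ n) ⊆ V)

module Submission where

-- Let cA and cB be programs
-- enumerating the subset relations of (𝒜 , ν) and (𝓑 , ν).  Given an oracle φ for x
-- in (𝒜 , ν), the program ψ answers query n by dovetailing: it looks for the least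
-- stage t at which, for some b , m ≤ t, it has been confirmed within t steps that
--   b ∈ dom_𝓑 ν  (cB enumerates ⟨b , b⟩),  ν(φ m) ⊆ ν b  and  ν b ⊆ ν(φ n)  (cA),
-- and outputs the least such b.  Such b and m exist because 𝓑 ⊆ 𝒜 are bases of the
-- same topology; then x ∈ ν(φ m) ⊆ ν(ψ n) ⊆ ν(φ n), so ψ is an oracle for x in
-- (𝓑 , ν), and the program does not depend on φ.

open import Data.Nat using (ℕ; zero; suc; _+_; _<_; _≤_; _⊔_; z≤n; _≟_)
open import Data.Nat.Properties
open import Data.Fin using (Fin; zero; suc; #_; _↑ʳ_)
open import Data.Vec using (Vec; []; _∷_; _++_; lookup)
open import Data.Product using (Σ; ∃; _×_; _,_; proj₁; proj₂)
open import Data.Sum using (_⊎_; inj₁; inj₂)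
open import Data.Empty using (⊥-elim)
open import Function using (id; _∘_)
open import Function.Bundles using (Equivalence)
open import Relation.Nullary using (¬_; yes; no)
open import Relation.Binary using (tri<; tri≈; tri>)
open import Relation.Binary.PropositionalEquality
open import Relation.Unary using (_⊆_)
open import Relation.Unary.Properties using (≐-trans)
open import Defs

open Equivalence using (to; from)

-- (1) Writing codes

projs : ∀ {k n} → (Fin k → Fin n) → Vec (Code n) k
projs {zero} ρ = []
projs {suc k} ρ = proj (ρ zero) ∷ projs (ρ ∘ suc)

projs-shift : ∀ {α k n} (ρ : Fin k → Fin n) {x xs ys} →
  EvalAll α (projs ρ) xs ys → EvalAll α (projs (suc ∘ ρ)) (x ∷ xs) ys
projs-shift {k = zero} ρ [] = []
projs-shift {k = suc k} ρ (eproj ∷ es) = eproj ∷ projs-shift (ρ ∘ suc) es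

projs-id : ∀ {α n} (xs : Vec ℕ n) → EvalAll α (projs id) xs xs
projs-id [] = []
projs-id (x ∷ xs) = eproj ∷ projs-shift id (projs-id xs)

after : ∀ {n} j → Vec (Code (j + n)) n
after j = projs (j ↑ʳ_)

after-eval : ∀ {α n j} {xs : Vec ℕ n} (ys : Vec ℕ j) → EvalAll α (after j) (ys ++ xs) xs
after-eval {xs = xs} [] = projs-id xs
after-eval {j = suc j} (y ∷ ys) = projs-shift (j ↑ʳ_) (after-eval ys)

lit : ∀ {k} → ℕ → Code k
lit zero = zer
lit (suc n) = comp succ (lit n ∷ [])

lit-eval : ∀ {α k} n {xs : Vec ℕ k} → Eval α (lit n) xs n
lit-eval zero = ezer
lit-eval (suc n) = ecomp (lit-eval n ∷ []) esucc

succC : ∀ {k} → Code k → Code k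
succC c = comp succ (c ∷ [])

succ-eval : ∀ {α k} {c : Code k} {xs v} → Eval α c xs v → Eval α (succC c) xs (suc v)
succ-eval e = ecomp (e ∷ []) esucc

weaken : ∀ {k} → Code k → Code (suc k)
weaken c = comp c (after 1)

weaken-eval : ∀ {α k} {c : Code k} {x xs v} → Eval α c xs v → Eval α (weaken c) (x ∷ xs) v
weaken-eval e = ecomp (after-eval (_ ∷ [])) e

primrec : ℕ → (ℕ → ℕ → ℕ) → ℕ → ℕ
primrec u G zero = u
primrec u G (suc n) = G n (primrec u G n)

prec-eval : ∀ {α k} {f : Code k} {g xs u} {G : ℕ → ℕ → ℕ} → Eval α f xs u →
  (∀ n acc → Eval α g (n ∷ acc ∷ xs) (G n acc)) →
  ∀ n → Eval α (prec f g) (n ∷ xs) (primrec u G n)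
prec-eval ef eg zero = eprec0 ef
prec-eval ef eg (suc n) = eprecS (prec-eval ef eg n) (eg n _)

-- Case distinction on zero / successor, as a function and as a code
-- (a primitive recursion whose step ignores the accumulator).
caseℕ : ℕ → ℕ → (ℕ → ℕ) → ℕ
caseℕ zero u g = u
caseℕ (suc p) u g = g p

caseC : ∀ {k} → Code k → Code k → Code (suc k) → Code k
caseC A F G = comp (prec F (comp G (proj zero ∷ after 2))) (A ∷ projs id)

case-eval : ∀ {α k} {A F : Code k} {G : Code (suc k)} {xs a u} {g : ℕ → ℕ} →
  Eval α A xs a → Eval α F xs u → (∀ p → Eval α G (p ∷ xs) (g p)) →
  Eval α (caseC A F G) xs (caseℕ a u g)
case-eval {xs = xs} {a = zero} eA eF eG = ecomp (eA ∷ projs-id xs) (eprec0 eF)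
case-eval {xs = xs} {a = suc p} {g = g} eA eF eG =
  ecomp (eA ∷ projs-id xs)
    (prec-eval {G = λ n _ → g n} eF
      (λ n acc → ecomp (eproj ∷ after-eval (n ∷ acc ∷ [])) (eG n)) (suc p))

-- (2) Clocked evaluation
-- A clocked value is 0 ("not seen to halt yet") or suc v ("halted with output v").
-- Clocked evaluation at stage s runs codes without oracle (the oracle λ _ → 0) and
-- bounds every minimisation search by s.

-- Unbounded search for the least zero of F, scanned up to a bound, where F j is the
-- clocked value of the searched function at j.  The scan state is 0 (some value is
-- not known yet), 1 (all values so far are positive), or suc (suc y) (least zero y).
scanStep : ℕ → ℕ → ℕ → ℕ
scanStep r j a = caseℕ a 0 (λ a′ → caseℕ a′
  (caseℕ r 0 (λ r′ → caseℕ r′ (suc (suc j)) (λ _ → 1)))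
  (λ _ → a))

scan : (ℕ → ℕ) → ℕ → ℕ
scan F = primrec 1 (λ j a → scanStep (F j) j a)

scanResult : ℕ → ℕ
scanResult a = caseℕ a 0 (λ a′ → caseℕ a′ 0 suc)

scanStepC : Code 3
scanStepC = caseC (proj (# 2)) (lit 0) (caseC (proj (# 0))
  (caseC (proj (# 1)) (lit 0) (caseC (proj (# 0)) (succC (succC (proj (# 3)))) (lit 1)))
  (proj (# 4)))

scanStep-eval : ∀ {α} r j a → Eval α scanStepC (r ∷ j ∷ a ∷ []) (scanStep r j a)
scanStep-eval r j a = case-eval eproj (lit-eval 0) (λ _ → case-eval eproj
  (case-eval eproj (lit-eval 0) (λ _ → case-eval eproj (succ-eval (succ-eval eproj)) (λ _ → lit-eval 1)))
  (λ _ → eproj))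

scanResultC : Code 1
scanResultC = caseC (proj zero) (lit 0) (caseC (proj zero) (lit 0) (succC (proj zero)))

scanResult-eval : ∀ {α} a → Eval α scanResultC (a ∷ []) (scanResult a)
scanResult-eval a = case-eval eproj (lit-eval 0) (λ _ → case-eval eproj (lit-eval 0) (λ _ → succ-eval eproj))

PositiveBelow : (ℕ → ℕ) → ℕ → Set
PositiveBelow F y = ∀ z → z < y → ∃ λ w → F z ≡ suc (suc w)

scan-searching : ∀ F j → scan F j ≡ 1 → PositiveBelow F j
scan-searching F (suc j) h z z<j with scan F j in previous
... | suc zero with F j in eF
...   | suc (suc w) with m≤n⇒m<n∨m≡n (≤-pred z<j)
...     | inj₁ z<j′ = scan-searching F j previous z z<j′
...     | inj₂ refl = w , eF
scan-searching F (suc j) () z z<j | suc zero | suc zero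
scan-searching F (suc j) () z z<j | suc zero | zero
scan-searching F (suc j) () z z<j | zero
scan-searching F (suc j) () z z<j | suc (suc y)

scan-found : ∀ F j y → scan F j ≡ suc (suc y) → (F y ≡ 1) × PositiveBelow F y
scan-found F (suc j) y h with scan F j in previous
... | suc (suc y′) = scan-found F j y (trans previous h)
... | suc zero with F j in eF
...   | suc zero with h
...     | refl = eF , scan-searching F j previous
scan-found F (suc j) y () | suc zero | suc (suc w)
scan-found F (suc j) y () | suc zero | zero
scan-found F (suc j) y () | zero

scan-searching-below : ∀ F y → PositiveBelow F y → ∀ j → j ≤ y → scan F j ≡ 1
scan-searching-below F y pos zero j≤y = refl
scan-searching-below F y pos (suc j) j≤y
  with scan F j | scan-searching-below F y pos j (≤-trans (n≤1+n j) j≤y)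
... | .1 | refl with F j | proj₂ (pos j j≤y)
...   | .(suc (suc _)) | refl = refl

scan-finds : ∀ F y → F y ≡ 1 → PositiveBelow F y → ∀ s → y < s → scan F s ≡ suc (suc y)
scan-finds F y zeroAt pos s y<s with m≤n⇒∃[o]m+o≡n y<s
... | d , refl = stays d
  where
  stays : ∀ d → scan F (suc y + d) ≡ suc (suc y)
  stays zero rewrite +-identityʳ y | scan-searching-below F y pos y ≤-refl | zeroAt = refl
  stays (suc d) rewrite +-suc y d | stays d = refl

mutual
  clock : ∀ {k} → Code k → ℕ → Vec ℕ k → ℕ
  clock zer s xs = 1
  clock succ s (x ∷ []) = suc (suc x)
  clock (proj i) s xs = suc (lookup xs i)
  clock orc s xs = 1
  clock (comp f gs) s xs = caseℕ (allHalt gs s xs) 0 (λ _ → clock f s (outputs gs s xs))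
  clock (prec f g) s (n ∷ xs) =
    primrec (clock f s xs) (λ j acc → caseℕ acc 0 (λ a → clock g s (j ∷ a ∷ xs))) n
  clock (mu f) s xs = scanResult (scan (λ j → clock f s (j ∷ xs)) s)

  allHalt : ∀ {k m} → Vec (Code k) m → ℕ → Vec ℕ k → ℕ
  allHalt [] s xs = 1
  allHalt (g ∷ gs) s xs = caseℕ (clock g s xs) 0 (λ _ → allHalt gs s xs)

  -- The outputs of gs at stage s (meaningful once all have halted).
  outputs : ∀ {k m} → Vec (Code k) m → ℕ → Vec ℕ k → Vec ℕ m
  outputs [] s xs = []
  outputs (g ∷ gs) s xs = caseℕ (clock g s xs) 0 id ∷ outputs gs s xs

mutual
  -- Clocked evaluation is computable: clockC c computes clock c, with the stage
  -- as an extra first argument (and without consulting the oracle).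
  clockC : ∀ {k} → Code k → Code (suc k)
  clockC zer = lit 1
  clockC succ = succC (succC (proj (# 1)))
  clockC (proj i) = succC (proj (suc i))
  clockC orc = lit 1
  clockC (comp f gs) = caseC (allHaltC gs) (lit 0) (weaken (comp (clockC f) (proj zero ∷ outputsC gs)))
  clockC (prec f g) =
    comp (prec (clockC f) (caseC (proj (# 1)) (lit 0)
                            (comp (clockC g) (proj (# 3) ∷ proj (# 1) ∷ proj (# 0) ∷ after 4))))
         (proj (# 1) ∷ proj (# 0) ∷ after 2)
  clockC (mu f) =
    comp scanResultC
      (comp (prec (lit 1) (comp scanStepC (comp (clockC f) (proj (# 2) ∷ proj (# 0) ∷ after 3)
                                            ∷ proj (# 0) ∷ proj (# 1) ∷ [])))
            (proj (# 0) ∷ proj (# 0) ∷ after 1) ∷ [])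

  allHaltC : ∀ {k m} → Vec (Code k) m → Code (suc k)
  allHaltC [] = lit 1
  allHaltC (g ∷ gs) = caseC (clockC g) (lit 0) (weaken (allHaltC gs))

  outputsC : ∀ {k m} → Vec (Code k) m → Vec (Code (suc k)) m
  outputsC [] = []
  outputsC (g ∷ gs) = caseC (clockC g) (lit 0) (proj zero) ∷ outputsC gs

mutual
  clock-eval : ∀ {α k} (c : Code k) s xs → Eval α (clockC c) (s ∷ xs) (clock c s xs)
  clock-eval zer s xs = lit-eval 1
  clock-eval succ s (x ∷ []) = succ-eval (succ-eval eproj)
  clock-eval (proj i) s xs = succ-eval eproj
  clock-eval orc s xs = lit-eval 1
  clock-eval (comp f gs) s xs = case-eval (allHalt-eval gs s xs) (lit-eval 0)
    (λ _ → weaken-eval (ecomp (eproj ∷ outputs-eval gs s xs) (clock-eval f s _)))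
  clock-eval (prec f g) s (n ∷ xs) =
    ecomp (eproj ∷ eproj ∷ after-eval (s ∷ n ∷ []))
      (prec-eval (clock-eval f s xs)
        (λ j acc → case-eval eproj (lit-eval 0)
          (λ a → ecomp (eproj ∷ eproj ∷ eproj ∷ after-eval (a ∷ j ∷ acc ∷ s ∷ []))
                       (clock-eval g s (j ∷ a ∷ xs))))
        n)
  clock-eval (mu f) s xs =
    ecomp (ecomp (eproj ∷ eproj ∷ after-eval (s ∷ []))
            (prec-eval (lit-eval 1)
              (λ j a → ecomp (ecomp (eproj ∷ eproj ∷ after-eval (j ∷ a ∷ s ∷ [])) (clock-eval f s (j ∷ xs))
                              ∷ eproj ∷ eproj ∷ [])
                             (scanStep-eval _ j a))
              s) ∷ [])
          (scanResult-eval _)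

  allHalt-eval : ∀ {α k m} (gs : Vec (Code k) m) s xs → Eval α (allHaltC gs) (s ∷ xs) (allHalt gs s xs)
  allHalt-eval [] s xs = lit-eval 1
  allHalt-eval (g ∷ gs) s xs = case-eval (clock-eval g s xs) (lit-eval 0) (λ _ → weaken-eval (allHalt-eval gs s xs))

  outputs-eval : ∀ {α k m} (gs : Vec (Code k) m) s xs → EvalAll α (outputsC gs) (s ∷ xs) (outputs gs s xs)
  outputs-eval [] s xs = []
  outputs-eval (g ∷ gs) s xs = case-eval (clock-eval g s xs) (lit-eval 0) (λ _ → eproj) ∷ outputs-eval gs s xs

-- The oracle under which clocked evaluation is faithful.
noOracle : ℕ → ℕ
noOracle _ = 0

mutual
  clock-sound : ∀ {k} (c : Code k) s xs v → clock c s xs ≡ suc v → Eval noOracle c xs v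
  clock-sound zer s xs .0 refl = ezer
  clock-sound succ s (x ∷ []) .(suc x) refl = esucc
  clock-sound (proj i) s xs _ refl = eproj
  clock-sound orc s (x ∷ []) .0 refl = eorc
  clock-sound (comp f gs) s xs v h with allHalt gs s xs in halted
  ... | suc _ = ecomp (allHalt-sound gs s xs halted) (clock-sound f s _ v h)
  clock-sound (prec f g) s (n ∷ xs) v h = iteration n v h
    where
    iteration : ∀ n v → clock (prec f g) s (n ∷ xs) ≡ suc v → Eval noOracle (prec f g) (n ∷ xs) v
    iteration zero v h = eprec0 (clock-sound f s xs v h)
    iteration (suc j) v h with clock (prec f g) s (j ∷ xs) in previous
    ... | suc a = eprecS (iteration j a previous) (clock-sound g s (j ∷ a ∷ xs) v h)
  clock-sound (mu f) s xs v h with scan (λ j → clock f s (j ∷ xs)) s in scanned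
  ... | suc (suc y) with h
  ...   | refl = emu (clock-sound f s (y ∷ xs) 0 zeroAt)
                     (λ z z<y → let (w , e) = pos z z<y in w , clock-sound f s (z ∷ xs) (suc w) e)
    where
    found = scan-found (λ j → clock f s (j ∷ xs)) s y scanned
    zeroAt = proj₁ found
    pos = proj₂ found

  allHalt-sound : ∀ {k m} (gs : Vec (Code k) m) s xs {o} → allHalt gs s xs ≡ suc o →
    EvalAll noOracle gs xs (outputs gs s xs)
  allHalt-sound [] s xs h = []
  allHalt-sound (g ∷ gs) s xs h with clock g s xs in halted
  ... | suc y = clock-sound g s xs y halted ∷ allHalt-sound gs s xs h

Eventually : (ℕ → Set) → Set
Eventually P = ∃ λ s₀ → ∀ s → s₀ ≤ s → P s

eventually-both : ∀ {P Q : ℕ → Set} → Eventually P → Eventually Q → Eventually (λ s → P s × Q s)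
eventually-both (a , pa) (b , qb) =
  a ⊔ b , λ s le → pa s (≤-trans (m≤m⊔n a b) le) , qb s (≤-trans (m≤n⊔m a b) le)

eventually-above : ∀ n → Eventually (n ≤_)
eventually-above n = n , λ _ le → le

eventually-holds : ∀ {P : ℕ → Set} → Eventually P → ∃ P
eventually-holds (s₀ , p) = s₀ , p s₀ ≤-refl

eventually-below : (P : ℕ → ℕ → Set) → ∀ y → (∀ z → z < y → Eventually (P z)) →
  Eventually (λ s → ∀ z → z < y → P z s)
eventually-below P zero ev = 0 , λ s _ z ()
eventually-below P (suc y) ev
  with eventually-both (eventually-below P y (λ z z<y → ev z (≤-trans z<y (n≤1+n y)))) (ev y ≤-refl)
... | s₀ , both = s₀ , λ s le z z<sy → split (m≤n⇒m<n∨m≡n (≤-pred z<sy)) (both s le)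
  where
  split : ∀ {z s} → z < y ⊎ z ≡ y → (∀ z → z < y → P z s) × P y s → P z s
  split (inj₁ z<y) (below , _) = below _ z<y
  split (inj₂ refl) (_ , atY) = atY

mutual
  clock-complete : ∀ {k} {c : Code k} {xs v} → Eval noOracle c xs v → Eventually (λ s → clock c s xs ≡ suc v)
  clock-complete ezer = 0 , λ _ _ → refl
  clock-complete esucc = 0 , λ _ _ → refl
  clock-complete eproj = 0 , λ _ _ → refl
  clock-complete eorc = 0 , λ _ _ → refl
  clock-complete {c = comp f gs} {xs = xs} {v = v} (ecomp {ys = ys} eas ef)
    with eventually-both (allHalt-complete eas) (clock-complete ef)
  ... | s₀ , both = s₀ , λ s le → compose s (both s le)
    where
    compose : ∀ s → ((allHalt gs s xs ≡ 1) × (outputs gs s xs ≡ ys)) × (clock f s ys ≡ suc v) →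
      clock (comp f gs) s xs ≡ suc v
    compose s ((halted , outs) , hf) rewrite halted | outs = hf
  clock-complete (eprec0 ef) = clock-complete ef
  clock-complete {c = prec f g} {xs = suc n ∷ xs} {v = v} (eprecS {w = w} ep eg)
    with eventually-both (clock-complete ep) (clock-complete eg)
  ... | s₀ , both = s₀ , λ s le → step s (both s le)
    where
    step : ∀ s → (clock (prec f g) s (n ∷ xs) ≡ suc w) × (clock g s (n ∷ w ∷ xs) ≡ suc v) →
      clock (prec f g) s (suc n ∷ xs) ≡ suc v
    step s (hp , hg) rewrite hp = hg
  clock-complete {c = mu f} {xs = xs} {v = y} (emu ef below)
    with eventually-both (eventually-both (clock-complete ef)
           (eventually-below (λ z s → ∃ λ w → clock f s (z ∷ xs) ≡ suc (suc w)) y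
              (λ z z<y → let (w , e) = below z z<y
                             (s₀ , seen) = clock-complete e
                         in s₀ , λ s le → w , seen s le)))
           (eventually-above (suc y))
  ... | s₀ , all = s₀ , λ s le →
    let ((zeroAt , pos) , y<s) = all s le
    in cong scanResult (scan-finds (λ j → clock f s (j ∷ xs)) y zeroAt pos s y<s)

  allHalt-complete : ∀ {k m} {gs : Vec (Code k) m} {xs ys} → EvalAll noOracle gs xs ys →
    Eventually (λ s → (allHalt gs s xs ≡ 1) × (outputs gs s xs ≡ ys))
  allHalt-complete [] = 0 , λ _ _ → refl , refl
  allHalt-complete {gs = g ∷ gs} {xs = xs} {ys = y ∷ ys} (e ∷ es)
    with eventually-both (clock-complete e) (allHalt-complete es)
  ... | s₀ , both = s₀ , λ s le → cons s (both s le)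
    where
    cons : ∀ s → (clock g s xs ≡ suc y) × ((allHalt gs s xs ≡ 1) × (outputs gs s xs ≡ ys)) →
      (allHalt (g ∷ gs) s xs ≡ 1) × (outputs (g ∷ gs) s xs ≡ y ∷ ys)
    cons s (hg , (halted , outs)) rewrite hg | halted | outs = refl , refl

-- (3) Cantor pairing

addC : Code 2
addC = prec (proj zero) (succC (proj (# 1)))

add-eval : ∀ {α} n y → Eval α addC (n ∷ y ∷ []) (n + y)
add-eval n y = subst (Eval _ addC _) (iterated-suc n) (prec-eval eproj (λ _ _ → succ-eval eproj) n)
  where
  iterated-suc : ∀ n → primrec y (λ _ acc → suc acc) n ≡ n + y
  iterated-suc zero = refl
  iterated-suc (suc n) = cong suc (iterated-suc n)

triC : Code 1
triC = prec zer (succC (comp addC (proj (# 0) ∷ proj (# 1) ∷ [])))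

tri-eval : ∀ {α} n → Eval α triC (n ∷ []) (tri n)
tri-eval n = subst (Eval _ triC _) (is-tri n)
  (prec-eval ezer (λ j acc → succ-eval (ecomp (eproj ∷ eproj ∷ []) (add-eval j acc))) n)
  where
  is-tri : ∀ n → primrec 0 (λ n acc → suc (n + acc)) n ≡ tri n
  is-tri zero = refl
  is-tri (suc n) = cong (λ t → suc (n + t)) (is-tri n)

pairC : ∀ {k} → Code k → Code k → Code k
pairC A B = comp addC (comp triC (comp addC (A ∷ B ∷ []) ∷ []) ∷ B ∷ [])

pair-eval : ∀ {α k} {A B : Code k} {xs a b} → Eval α A xs a → Eval α B xs b →
  Eval α (pairC A B) xs ⟨ a , b ⟩
pair-eval {a = a} {b} eA eB =
  ecomp (ecomp (ecomp (eA ∷ eB ∷ []) (add-eval a b) ∷ []) (tri-eval (a + b)) ∷ eB ∷ []) (add-eval _ b)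

tri-mono : ∀ {p q} → p ≤ q → tri p ≤ tri q
tri-mono {p} p≤q with m≤n⇒∃[o]m+o≡n p≤q
... | d , refl = grows d
  where
  grows : ∀ d → tri p ≤ tri (p + d)
  grows zero rewrite +-identityʳ p = ≤-refl
  grows (suc d) rewrite +-suc p d = ≤-trans (grows d) (m≤n+m (tri (p + d)) (suc (p + d)))

pair-< : ∀ a b c d → a + b < c + d → ⟨ a , b ⟩ < ⟨ c , d ⟩
pair-< a b c d lt = begin-strict
    tri (a + b) + b
  ≤⟨ +-monoʳ-≤ (tri (a + b)) (m≤n+m b a) ⟩
    tri (a + b) + (a + b)
  <⟨ +-monoʳ-< (tri (a + b)) (n<1+n (a + b)) ⟩
    tri (a + b) + suc (a + b)
  ≡⟨ +-comm (tri (a + b)) (suc (a + b)) ⟩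
    tri (suc (a + b))
  ≤⟨ tri-mono lt ⟩
    tri (c + d)
  ≤⟨ m≤m+n (tri (c + d)) d ⟩
    tri (c + d) + d
  ∎
  where open ≤-Reasoning

pair-injective : ∀ {a b c d} → ⟨ a , b ⟩ ≡ ⟨ c , d ⟩ → (a ≡ c) × (b ≡ d)
pair-injective {a} {b} {c} {d} h with <-cmp (a + b) (c + d)
... | tri< lt _ _ = ⊥-elim (<-irrefl h (pair-< a b c d lt))
... | tri> _ _ gt = ⊥-elim (<-irrefl (sym h) (pair-< c d a b gt))
... | tri≈ _ sums _ = a≡c , b≡d
  where
  b≡d : b ≡ d
  b≡d = +-cancelˡ-≡ (tri (a + b)) b d (trans h (cong (λ t → tri t + d) (sym sums)))
  a≡c : a ≡ c
  a≡c = +-cancelʳ-≡ b a c (trans sums (cong (c +_) (sym b≡d)))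

-- (4) Bounded search and minimisation

boundedZero : (ℕ → ℕ) → ℕ → ℕ
boundedZero g = primrec (g 0) (λ j acc → caseℕ (g (suc j)) 0 (λ _ → acc))

boundedZeroC : ∀ {k} → Code (suc k) → Code (suc k)
boundedZeroC G = prec (comp G (lit 0 ∷ after 0))
  (caseC (comp G (succC (proj zero) ∷ after 2)) (lit 0) (proj (# 2)))

boundedZero-eval : ∀ {α k} {G : Code (suc k)} {xs : Vec ℕ k} {g : ℕ → ℕ} →
  (∀ z → Eval α G (z ∷ xs) (g z)) → ∀ u → Eval α (boundedZeroC G) (u ∷ xs) (boundedZero g u)
boundedZero-eval eG = prec-eval (ecomp (lit-eval 0 ∷ after-eval []) (eG 0))
  (λ j acc → case-eval (ecomp (succ-eval eproj ∷ after-eval (j ∷ acc ∷ [])) (eG (suc j))) (lit-eval 0) (λ _ → eproj))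

boundedZero-witness : ∀ g u → boundedZero g u ≡ 0 → ∃ λ z → z ≤ u × g z ≡ 0
boundedZero-witness g zero h = 0 , z≤n , h
boundedZero-witness g (suc u) h with g (suc u) in eq
... | zero = suc u , ≤-refl , eq
... | suc _ = let (z , le , e) = boundedZero-witness g u h in z , ≤-trans le (n≤1+n u) , e

boundedZero-intro : ∀ g u z → z ≤ u → g z ≡ 0 → boundedZero g u ≡ 0
boundedZero-intro g zero .zero z≤n h = h
boundedZero-intro g (suc u) z le h with m≤n⇒m<n∨m≡n le
... | inj₂ refl rewrite h = refl
... | inj₁ lt with g (suc u)
...   | zero = refl
...   | suc _ = boundedZero-intro g u z (≤-pred lt) h

LeastZero : (ℕ → ℕ) → ℕ → Set
LeastZero F y = (F y ≡ 0) × (∀ z → z < y → ¬ F z ≡ 0)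

search : ∀ (F : ℕ → ℕ) n → (∃ (LeastZero F)) ⊎ (∀ z → z < n → ¬ F z ≡ 0)
search F zero = inj₂ (λ z ())
search F (suc n) with search F n
... | inj₁ found = inj₁ found
... | inj₂ none with F n ≟ 0
...   | yes zeroAt = inj₁ (n , zeroAt , none)
...   | no nonzero = inj₂ (λ z lt → extend (m≤n⇒m<n∨m≡n (≤-pred lt)))
  where
  extend : ∀ {z} → z < n ⊎ z ≡ n → ¬ F z ≡ 0
  extend (inj₁ z<n) = none _ z<n
  extend (inj₂ refl) = nonzero

least : ∀ (F : ℕ → ℕ) → ∃ (λ y → F y ≡ 0) → ∃ (LeastZero F)
least F (y , zeroAt) with search F (suc y)
... | inj₁ found = found
... | inj₂ none = ⊥-elim (none y ≤-refl zeroAt)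

mu-eval : ∀ {α k} {f : Code (suc k)} {xs : Vec ℕ k} {F : ℕ → ℕ} {y} →
  (∀ z → Eval α f (z ∷ xs) (F z)) → LeastZero F y → Eval α (mu f) xs y
mu-eval {F = F} eF (zeroAt , nonzero) = emu (subst (Eval _ _ _) zeroAt (eF _)) (λ z lt → positive z (nonzero z lt))
  where
  positive : ∀ z → ¬ F z ≡ 0 → ∃ λ w → Eval _ _ _ (suc w)
  positive z ne with F z | eF z
  ... | zero | _ = ⊥-elim (ne refl)
  ... | suc w | e = w , e

-- (5) The search program

Positive : ℕ → Set
Positive n = ∃ λ v → n ≡ suc v

allPositive : ℕ → ℕ → ℕ → ℕ
allPositive a b c = caseℕ a 1 (λ _ → caseℕ b 1 (λ _ → caseℕ c 1 (λ _ → 0)))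

allPositiveC : Code 3
allPositiveC = caseC (proj (# 0)) (lit 1) (caseC (proj (# 2)) (lit 1) (caseC (proj (# 4)) (lit 1) (lit 0)))

allPositive-eval : ∀ {α} a b c → Eval α allPositiveC (a ∷ b ∷ c ∷ []) (allPositive a b c)
allPositive-eval a b c =
  case-eval eproj (lit-eval 1) (λ _ → case-eval eproj (lit-eval 1) (λ _ → case-eval eproj (lit-eval 1) (λ _ → lit-eval 0)))

allPositive-elim : ∀ a b c → allPositive a b c ≡ 0 → Positive a × Positive b × Positive c
allPositive-elim (suc a) (suc b) (suc c) refl = (a , refl) , (b , refl) , (c , refl)

allPositive-intro : ∀ {a b c} → Positive a → Positive b → Positive c → allPositive a b c ≡ 0
allPositive-intro (_ , refl) (_ , refl) (_ , refl) = refl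

module Search (cA cB : Code 1) where

  seenC : ∀ {k} → Code 1 → Code k → Code k → Code k → Code k
  seenC c T A B = comp (clockC c) (T ∷ pairC A B ∷ [])

  seen-eval : ∀ {α k} (c : Code 1) {T A B : Code k} {xs t a b} →
    Eval α T xs t → Eval α A xs a → Eval α B xs b →
    Eval α (seenC c T A B) xs (clock c t (⟨ a , b ⟩ ∷ []))
  seen-eval c {t = t} {a} {b} eT eA eB = ecomp (eT ∷ pair-eval eA eB ∷ []) (clock-eval c t (⟨ a , b ⟩ ∷ []))

  cert : (ℕ → ℕ) → ℕ → ℕ → ℕ → ℕ → ℕ
  cert φ m b t n = allPositive (clock cB t (⟨ b , b ⟩ ∷ []))
                               (clock cA t (⟨ φ m , b ⟩ ∷ []))
                               (clock cA t (⟨ b , φ n ⟩ ∷ []))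

  certC : Code 4
  certC = comp allPositiveC
    ( seenC cB (proj (# 2)) (proj (# 1)) (proj (# 1))
    ∷ seenC cA (proj (# 2)) (comp orc (proj (# 0) ∷ [])) (proj (# 1))
    ∷ seenC cA (proj (# 2)) (proj (# 1)) (comp orc (proj (# 3) ∷ []))
    ∷ [])

  cert-eval : ∀ φ m b t n → Eval φ certC (m ∷ b ∷ t ∷ n ∷ []) (cert φ m b t n)
  cert-eval φ m b t n = ecomp
    ( seen-eval cB eproj eproj eproj
    ∷ seen-eval cA eproj (ecomp (eproj ∷ []) eorc) eproj
    ∷ seen-eval cA eproj eproj (ecomp (eproj ∷ []) eorc)
    ∷ [])
    (allPositive-eval _ _ _)

  certB : (ℕ → ℕ) → ℕ → ℕ → ℕ → ℕ
  certB φ b t n = boundedZero (λ m → cert φ m b t n) t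

  certBC : Code 3
  certBC = comp (boundedZeroC certC) (proj (# 1) ∷ proj (# 0) ∷ proj (# 1) ∷ proj (# 2) ∷ [])

  certB-eval : ∀ φ b t n → Eval φ certBC (b ∷ t ∷ n ∷ []) (certB φ b t n)
  certB-eval φ b t n = ecomp (eproj ∷ eproj ∷ eproj ∷ eproj ∷ []) (boundedZero-eval (λ m → cert-eval φ m b t n) t)

  certT : (ℕ → ℕ) → ℕ → ℕ → ℕ
  certT φ t n = boundedZero (λ b → certB φ b t n) t

  certTC : Code 2
  certTC = comp (boundedZeroC certBC) (proj (# 0) ∷ proj (# 0) ∷ proj (# 1) ∷ [])

  certT-eval : ∀ φ t n → Eval φ certTC (t ∷ n ∷ []) (certT φ t n)
  certT-eval φ t n = ecomp (eproj ∷ eproj ∷ eproj ∷ []) (boundedZero-eval (λ b → certB-eval φ b t n) t)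

  certT-intro : ∀ {φ m b t n} → m ≤ t → b ≤ t → cert φ m b t n ≡ 0 → certT φ t n ≡ 0
  certT-intro {φ} {m} {b} {t} {n} m≤t b≤t ok =
    boundedZero-intro (λ b → certB φ b t n) t b b≤t (boundedZero-intro (λ m → cert φ m b t n) t m m≤t ok)

  -- The least certified stage, and the least b certified at that stage.
  stageC : Code 1
  stageC = mu certTC

  oracleC : Code 1
  oracleC = mu (comp certBC (proj (# 0) ∷ comp stageC (proj (# 1) ∷ []) ∷ proj (# 1) ∷ []))

  oracle-run : ∀ φ → (∀ n → ∃ λ t → certT φ t n ≡ 0) →
    Σ (ℕ → ℕ) λ ψ → (∀ n → Eval φ oracleC (n ∷ []) (ψ n)) ×
                    (∀ n → ∃ λ m → ∃ λ t → cert φ m (ψ n) t n ≡ 0)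
  oracle-run φ certified = ψ , run , certifiedψ
    where
    stage : ∀ n → ∃ (LeastZero (λ t → certT φ t n))
    stage n = least (λ t → certT φ t n) (certified n)

    T : ℕ → ℕ
    T n = proj₁ (stage n)

    stage-eval : ∀ n → Eval φ stageC (n ∷ []) (T n)
    stage-eval n = mu-eval (λ t → certT-eval φ t n) (proj₂ (stage n))

    choice : ∀ n → ∃ (LeastZero (λ b → certB φ b (T n) n))
    choice n = let (b , _ , ok) = boundedZero-witness (λ b → certB φ b (T n) n) (T n) (proj₁ (proj₂ (stage n)))
               in least (λ b → certB φ b (T n) n) (b , ok)

    ψ : ℕ → ℕ
    ψ n = proj₁ (choice n)

    run : ∀ n → Eval φ oracleC (n ∷ []) (ψ n)
    run n = mu-eval (λ b → ecomp (eproj ∷ ecomp (eproj ∷ []) (stage-eval n) ∷ eproj ∷ []) (certB-eval φ b (T n) n))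
                    (proj₂ (choice n))

    certifiedψ : ∀ n → ∃ λ m → ∃ λ t → cert φ m (ψ n) t n ≡ 0
    certifiedψ n =
      let (m , _ , ok) = boundedZero-witness (λ m → cert φ m (ψ n) (T n) n) (T n) (proj₁ (proj₂ (choice n)))
      in m , T n , ok

-- (6) Clocked enumeration of a subset relation

module Enumerated {X : Set} (𝒜 : Family {X}) (ν : ℕ → Subset {X}) (rel : SubsetRelRE 𝒜 ν) where

  enumerator : Code 1
  enumerator = proj₁ rel

  Included : ℕ → ℕ → Set₁
  Included b₁ b₂ = Dom 𝒜 ν b₁ × Dom 𝒜 ν b₂ × ν b₁ ⊆ ν b₂

  included⇒seen : ∀ {b₁ b₂} → Included b₁ b₂ →
    Eventually (λ s → Positive (clock enumerator s (⟨ b₁ , b₂ ⟩ ∷ [])))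
  included⇒seen {b₁} {b₂} inc =
    let (v , halts) = to (proj₂ rel ⟨ b₁ , b₂ ⟩) (b₁ , b₂ , refl , inc)
        (s₀ , seen) = clock-complete halts
    in s₀ , λ s le → v , seen s le

  -- Every enumerated pair is included (soundness of clocking, injectivity of pairing).
  seen⇒included : ∀ {s b₁ b₂} → Positive (clock enumerator s (⟨ b₁ , b₂ ⟩ ∷ [])) → Included b₁ b₂
  seen⇒included {s} {b₁} {b₂} (v , seen) with from (proj₂ rel ⟨ b₁ , b₂ ⟩) (v , clock-sound enumerator s _ v seen)
  ... | a₁ , a₂ , pairs , inc with pair-injective {b₁} {b₂} {a₁} {a₂} pairs
  ...   | refl , refl = inc

-- (7) The topological step

basic-open : ∀ {X} {𝒜 : Family {X}} {V} → 𝒜 V → OpenIn 𝒜 V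
basic-open {V = V} AV y y∈V = V , AV , y∈V , id

module Refinement {X : Set} (𝒜 𝓑 : Family {X}) (ν : ℕ → Subset {X}) where

  dom-mono : 𝓑 ⊆ᶠ 𝒜 → ∀ {b} → Dom 𝓑 ν b → Dom 𝒜 ν b
  dom-mono B⊆A (V , BV , b≐V) = let (W , AW , V≐W) = B⊆A V BV in W , AW , ≐-trans b≐V V≐W

  Squeezed : (ℕ → ℕ) → ℕ → ℕ → ℕ → Set₁
  Squeezed φ m n b = Dom 𝓑 ν b × ν (φ m) ⊆ ν b × ν b ⊆ ν (φ n)

  -- Inside every ν(φ n) a coded 𝓑-set around x can be squeezed, because 𝓑 and 𝒜
  -- generate the same topology.
  squeeze : IsCoding 𝓑 ν → SameTopology 𝒜 𝓑 → ∀ {x φ} → IsOracleFor 𝒜 ν x φ →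
    ∀ n → ∃ λ b → ∃ λ m → Squeezed φ m n b
  squeeze codeB same {x} (domφ , memφ , locφ) n =
    let (W , AW , φn≐W) = domφ n
        (V , BV , x∈V , V⊆W) = to (same W) (basic-open AW) x (proj₁ φn≐W (memφ n))
        (b , b≐V) = codeB V BV
        (V₁ , AV₁ , x∈V₁ , V₁⊆V) = from (same V) (basic-open BV) x x∈V
        (m , φm⊆V₁) = locφ V₁ AV₁ x∈V₁
    in b , m , (V , BV , b≐V)
             , (λ p → proj₂ b≐V (V₁⊆V (φm⊆V₁ p)))
             , (λ p → proj₂ φn≐W (V⊆W (proj₁ b≐V p)))

  squeezed-oracle : 𝓑 ⊆ᶠ 𝒜 → ∀ {x φ ψ} → IsOracleFor 𝒜 ν x φ →
    (∀ n → ∃ λ m → Squeezed φ m n (ψ n)) → IsOracleFor 𝓑 ν x ψ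
  squeezed-oracle B⊆A (domφ , memφ , locφ) squeezed =
      (λ n → let (_ , domψ , _) = squeezed n in domψ)
    , (λ n → let (m , _ , φm⊆ψn , _) = squeezed n in φm⊆ψn (memφ m))
    , λ V BV x∈V →
        let (W , AW , V≐W) = B⊆A V BV
            (n , φn⊆W) = locφ W AW (proj₁ V≐W x∈V)
            (_ , _ , _ , ψn⊆φn) = squeezed n
        in n , λ p → proj₂ V≐W (φn⊆W (ψn⊆φn p))

-- (8) Certificates are exactly the squeezed sets, and the theorem

module Dovetailing {X : Set} (𝒜 𝓑 : Family {X}) (ν : ℕ → Subset {X})
                   (relA : SubsetRelRE 𝒜 ν) (relB : SubsetRelRE 𝓑 ν) where

  open Search (proj₁ relA) (proj₁ relB) public
  open Refinement 𝒜 𝓑 ν public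
  private
    module A = Enumerated 𝒜 ν relA
    module B = Enumerated 𝓑 ν relB

  cert-squeezed : ∀ φ n b → (∃ λ m → ∃ λ t → cert φ m b t n ≡ 0) → ∃ λ m → Squeezed φ m n b
  cert-squeezed φ n b (m , t , ok) =
    let (seenB , seenA₁ , seenA₂) = allPositive-elim _ _ _ ok
        (domB , _) = B.seen⇒included {t} {b} {b} seenB
        (_ , _ , φm⊆b) = A.seen⇒included {t} {φ m} {b} seenA₁
        (_ , _ , b⊆φn) = A.seen⇒included {t} {b} {φ n} seenA₂
    in m , domB , φm⊆b , b⊆φn

  squeezed-certified : 𝓑 ⊆ᶠ 𝒜 → ∀ {φ m n b} → (∀ k → Dom 𝒜 ν (φ k)) → Squeezed φ m n b →
    ∃ λ t → certT φ t n ≡ 0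
  squeezed-certified B⊆A {φ} {m} {n} {b} domφ (domB , φm⊆b , b⊆φn) =
    let domA = dom-mono B⊆A domB
        (t , (((seenB , seenA₁) , seenA₂) , m≤t) , b≤t) = eventually-holds
          (eventually-both (eventually-both (eventually-both (eventually-both
            (B.included⇒seen (domB , domB , id))
            (A.included⇒seen (domφ m , domA , φm⊆b)))
            (A.included⇒seen (domA , domφ n , b⊆φn)))
            (eventually-above m))
            (eventually-above b))
    in t , certT-intro {φ} {m} {b} {t} {n} m≤t b≤t (allPositive-intro seenB seenA₁ seenA₂)

theorem9 : {X : Set} (𝒜 𝓑 : Family {X}) (ν : ℕ → Subset {X}) →
    EffectiveTopology 𝒜 ν → EffectiveTopology 𝓑 ν →
    SubsetRelRE 𝒜 ν → SubsetRelRE 𝓑 ν →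
    𝓑 ⊆ᶠ 𝒜 → SameTopology 𝒜 𝓑 →
    ∃ λ (e : Code 1) → ∀ (x : X) (φ : ℕ → ℕ) → IsOracleFor 𝒜 ν x φ →
      Σ (ℕ → ℕ) λ ψ → (∀ n → Eval φ e (n ∷ []) (ψ n)) × IsOracleFor 𝓑 ν x ψ
theorem9 𝒜 𝓑 ν _ (_ , _ , codeB) relA relB B⊆A same = oracleC , oracle
  where
  open Dovetailing 𝒜 𝓑 ν relA relB
  oracle : ∀ x φ → IsOracleFor 𝒜 ν x φ →
    Σ (ℕ → ℕ) λ ψ → (∀ n → Eval φ oracleC (n ∷ []) (ψ n)) × IsOracleFor 𝓑 ν x ψ
  oracle x φ oracleφ =
    let certified n = let (_ , _ , squeezed) = squeeze codeB same oracleφ n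
                      in squeezed-certified B⊆A (proj₁ oracleφ) squeezed
        (ψ , run , certifiedψ) = oracle-run φ certified
    in ψ , run , squeezed-oracle B⊆A oracleφ (λ n → cert-squeezed φ n (ψ n) (certifiedψ n))
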